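{- Let $n\in\mathbb{Z}^+$. For every $d\in\mathbb{Z}^+$, every $C=[x_1]\times\cdots\times[x_d]$ with $x_1,\dots,x_d\in\mathbb{Z}^+$ and $|C|=n$, and every $\alpha\in\mathbb{Z}^+$, \[|\mathcal{T}(\alpha,C)|\le\max_{\alpha'\in\mathbb{Z}^+}|\mathcal{T}(\alpha',[n])|.\] (Equivalently, $\max_{\alpha,C}|\mathcal{T}(\alpha,C)|\le\max_{\alpha'}|\mathcal{T}(\alpha',[n])|$, the left maximum over all such boxes $C$ of size $n$ and all $\alpha$.)
   Context: $[n]=\{1,\dots,n\}$. $A+B$ is the Minkowski sum. For finite $C\subset\mathbb{Z}^d$ and $\alpha\in\mathbb{Z}^+$, $\mathcal{T}(\alpha,C)$ is the set of pairs $(A,B)$ of finite subsets of $\mathbb{Z}^d$ with $A+B=C$, $|C|=|A||B|$, $|A|=\alpha$, $(0,\dots,0)\in B$, and every coordinate of every element of $B$ nonnegative. -}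

module Defs where

open import Data.Nat as ℕ using (ℕ; zero; suc)
open import Data.Integer as ℤ using (ℤ; +_)
open import Data.Fin using (Fin)
open import Data.Vec using (Vec; lookup; zipWith; replicate; [_]; foldr′)
open import Data.List using (List; length)
open import Data.List.Membership.Propositional using (_∈_)
open import Data.List.Relation.Unary.Unique.Propositional using (Unique)
open import Data.List.Relation.Unary.All using (All)
open import Data.List.Relation.Unary.AllPairs using (AllPairs)
open import Data.Product using (Σ; _×_; ∃; ∃-syntax; _,_)
open import Relation.Binary.PropositionalEquality using (_≡_)
open import Relation.Nullary using (¬_)
open import Function.Bundles using (_⇔_)

vprod : ∀ {d} → Vec ℕ d → ℕ
vprod = foldr′ ℕ._*_ 1

-- Points of ℤ^d and finite subsets of ℤ^d, the latter as duplicate-free lists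
-- (so that |A| = length A).
Point : ℕ → Set
Point d = Vec ℤ d

FinSet : ℕ → Set
FinSet d = List (Point d)

_⊕_ : ∀ {d} → Point d → Point d → Point d
_⊕_ = zipWith ℤ._+_

origin : ∀ {d} → Point d
origin = replicate _ (+ 0)

InBox : ∀ {d} → Vec ℕ d → Point d → Set
InBox {d} x c = (i : Fin d) → (+ 1 ℤ.≤ lookup c i) × (lookup c i ℤ.≤ + lookup x i)

InSum : ∀ {d} → FinSet d → FinSet d → Point d → Set
InSum A B c = ∃[ a ] ∃[ b ] (a ∈ A × b ∈ B × c ≡ a ⊕ b)

NonNeg : ∀ {d} → Point d → Set
NonNeg {d} b = (i : Fin d) → + 0 ℤ.≤ lookup b i

InT : ∀ {d} → ℕ → Vec ℕ d → FinSet d × FinSet d → Set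
InT {d} α x (A , B) =
  Unique A × Unique B
  × (∀ (c : Point d) → InBox x c ⇔ InSum A B c)
  × (vprod x ≡ length A ℕ.* length B)
  × (length A ≡ α)
  × (origin ∈ B)
  × All NonNeg B

SameSet : ∀ {d} → FinSet d → FinSet d → Set
SameSet A A' = ∀ v → v ∈ A ⇔ v ∈ A'

SamePair : ∀ {d} → FinSet d × FinSet d → FinSet d × FinSet d → Set
SamePair (A , B) (A' , B') = SameSet A A' × SameSet B B'

HasSize : {X : Set} → (X → X → Set) → (X → Set) → ℕ → Set
HasSize {X} _≈_ P k =
  Σ (List X) λ L →
    (length L ≡ k) × All P L × AllPairs (λ p q → ¬ (p ≈ q)) L
    × (∀ p → P p → Data.List.Relation.Unary.Any.Any (p ≈_) L)
  where import Data.List.Relation.Unary.Any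

CardT : ∀ {d} → ℕ → Vec ℕ d → ℕ → Set
CardT α x k = HasSize SamePair (InT α x) k

interval : ℕ → Vec ℕ 1
interval n = [ n ]

module Submission where

-- Number the cells of C = [x₁] × ⋯ × [x_d] in mixed radix: the linear form
-- φ(c) = c₁ + x₁ (c₂ + x₂ (c₃ + ⋯)) maps C bijectively onto an interval of n
-- consecutive integers. Being additive, φ turns a factorisation A + B = C into
-- φA + φB = φC, so translating φA onto [n] (and leaving φB, which contains 0 and
-- is nonnegative, alone) maps 𝒯(α, C) injectively into 𝒯(α, [n]); take α′ = α.
-- That 𝒯(α, [n]) has a size at all is a finiteness argument, valid for any box:
-- A ⊆ C and, since a + B ⊆ C for a ∈ A, B ⊆ [0, x₁) × ⋯ × [0, x_d); so every
-- member of 𝒯 is set-equal to a pair of sublists of two fixed finite lists, and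
-- membership in 𝒯 is decidable.

open import Algebra.Bundles using (AbelianGroup)
open import Data.Bool using (true; false)
open import Data.Fin using (zero; suc)
import Data.Fin.Properties as Fin
open import Data.Integer as ℤ using (ℤ; +_; +≤+)
import Data.Integer.Properties as ℤ
open import Algebra.Properties.Group (AbelianGroup.group ℤ.+-0-abelianGroup) using (∙-cancelˡ)
open import Data.Integer.Tactic.RingSolver using (solve-∀)
open import Data.List
  using (List; []; _∷_; [_]; _++_; length; map; filter; deduplicate; cartesianProduct; cartesianProductWith; upTo)
import Data.List.Properties as List
open import Data.List.Membership.Propositional using (_∈_; find; lose)
open import Data.List.Membership.Propositional.Properties
  using ( ∈-filter⁺; ∈-filter⁻; ∈-map⁺; ∈-map⁻; ∈-++⁺ˡ; ∈-++⁺ʳ; ∈-upTo⁺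
        ; ∈-cartesianProductWith⁺; ∈-cartesianProduct⁺; ∈-deduplicate⁺)
import Data.List.Membership.DecPropositional as DecMembership
import Data.List.Membership.Setoid as SetoidMembership
import Data.List.Membership.Setoid.Properties as SetoidMembershipₚ
open import Data.List.Relation.Unary.All as All using (All; []; _∷_)
import Data.List.Relation.Unary.All.Properties as All
open import Data.List.Relation.Unary.AllPairs using ([]; _∷_; allPairs?)
open import Data.List.Relation.Unary.Any as Any using (Any; here; there)
import Data.List.Relation.Unary.Any.Properties as Any
open import Data.List.Relation.Unary.Unique.Propositional using (Unique)
import Data.List.Relation.Unary.Unique.Propositional.Properties as Unique
import Data.List.Relation.Unary.Unique.DecPropositional.Properties as DecUnique
import Data.List.Relation.Unary.Unique.Setoid as SetoidUnique
import Data.List.Relation.Unary.Unique.DecSetoid.Properties as DecSetoidUnique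
open import Data.Nat as ℕ using (ℕ; suc; _≤_; _<_; z≤n; s≤s)
open import Data.Nat.DivMod using (_/_; _%_; m≡m%n+[m/n]*n; m%n<n; m<n*o⇒m/o<n)
import Data.Nat.Properties as ℕ
open import Data.Product using (Σ; ∃; _×_; _,_; proj₁; proj₂)
open import Data.Vec as Vec using (Vec; []; _∷_)
import Data.Vec.Properties as Vec
open import Data.Vec.Relation.Binary.Pointwise.Inductive using (Pointwise; []; _∷_)
import Data.Vec.Relation.Unary.All as VecAll
open import Function using (_∘_; _⇔_; mk⇔; Equivalence)
import Function.Properties.Equivalence as ⇔
open import Relation.Binary using (tri<; tri≈; tri>)
open import Relation.Binary.Bundles using (Setoid; DecSetoid)
open import Relation.Binary.Definitions using (DecidableEquality)
import Relation.Binary.Definitions as B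
open import Relation.Binary.PropositionalEquality as ≡ using (_≡_; refl)
open import Relation.Nullary using (Dec; contradiction; does)
open import Relation.Nullary.Decidable using (_×-dec_; _→-dec_; map′; ¬?)
open import Relation.Unary using (Pred; Decidable)
open import Level using (0ℓ)

open import Defs

-- Counting up to an equivalence

module _ {c ℓ} (S : Setoid c ℓ) where
  open Setoid S using (_≉_) renaming (refl to ≈-refl; sym to ≈-sym; trans to ≈-trans)
  open SetoidMembership S using (_─_) renaming (_∈_ to _∈ₛ_)
  open SetoidUnique S using () renaming (Unique to Uniqueₛ)

  ∈-─ : ∀ {x y ys} (x∈ys : x ∈ₛ ys) → y ∈ₛ ys → x ≉ y → y ∈ₛ (ys ─ x∈ys)
  ∈-─ (here x≈z)   (here y≈z)   x≉y = contradiction (≈-trans x≈z (≈-sym y≈z)) x≉y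
  ∈-─ (here _)     (there y∈ys) _   = y∈ys
  ∈-─ (there _)    (here y≈z)   _   = here y≈z
  ∈-─ (there x∈ys) (there y∈ys) x≉y = there (∈-─ x∈ys y∈ys x≉y)

  Unique-⊆⇒length≤ : ∀ {xs ys} → Uniqueₛ xs → (∀ {x} → x ∈ₛ xs → x ∈ₛ ys) → length xs ≤ length ys
  Unique-⊆⇒length≤ {[]}          _            _     = z≤n
  Unique-⊆⇒length≤ {x ∷ xs} {ys} (x≉xs ∷ xs!) xs⊆ys = begin
    suc (length xs)           ≤⟨ s≤s (Unique-⊆⇒length≤ xs! xs⊆ys─x) ⟩
    suc (length (ys ─ x∈ys))  ≡⟨ List.length-removeAt′ ys (Any.index x∈ys) ⟨
    length ys                 ∎
    where
    open ℕ.≤-Reasoning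
    x∈ys = xs⊆ys (here ≈-refl)
    xs⊆ys─x : ∀ {y} → y ∈ₛ xs → y ∈ₛ (ys ─ x∈ys)
    xs⊆ys─x y∈xs = ∈-─ x∈ys (xs⊆ys (there y∈xs))
      (All.lookupWith (λ x≉z y≈z x≈y → x≉z (≈-trans x≈y y≈z)) x≉xs y∈xs)

module _ (S T : Setoid 0ℓ 0ℓ) where
  open Setoid S using () renaming (Carrier to X; _≈_ to _≈₁_)
  open Setoid T using () renaming (Carrier to Y; _≈_ to _≈₂_; trans to ≈₂-trans)
  open SetoidMembership T using () renaming (_∈_ to _∈₂_)

  Unique-map⁺ : ∀ {P : Pred X 0ℓ} {f : X → Y} {xs} →
    (∀ {p q} → P p → P q → f p ≈₂ f q → p ≈₁ q) →
    All P xs → SetoidUnique.Unique S xs → SetoidUnique.Unique T (map f xs)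
  Unique-map⁺ _     []         []           = []
  Unique-map⁺ f-inj (px ∷ pxs) (x≉xs ∷ xs!) =
    All.map⁺ (All.zipWith (λ (py , x≉y) → x≉y ∘ f-inj px py) (pxs , x≉xs))
    ∷ Unique-map⁺ f-inj pxs xs!

  HasSize-≤ : ∀ {P : Pred X 0ℓ} {Q : Pred Y 0ℓ} (f : X → Y) →
    (∀ {p} → P p → Q (f p)) → (∀ {p q} → P p → P q → f p ≈₂ f q → p ≈₁ q) →
    ∀ {k k′} → HasSize _≈₁_ P k → HasSize _≈₂_ Q k′ → k ≤ k′
  HasSize-≤ f f-pres f-inj (L , refl , PL , L! , _) (L′ , refl , _ , _ , L′-covers) = begin
    length L          ≡⟨ List.length-map f L ⟨
    length (map f L)  ≤⟨ Unique-⊆⇒length≤ T (Unique-map⁺ f-inj PL L!) fL⊆L′ ⟩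
    length L′         ∎
    where
    open ℕ.≤-Reasoning
    fL⊆L′ : ∀ {y} → y ∈₂ map f L → y ∈₂ L′
    fL⊆L′ y∈fL = All.lookupWith (λ Pp y≈fp → Any.map (≈₂-trans y≈fp) (L′-covers _ (f-pres Pp)))
                   PL (Any.map⁻ y∈fL)

module _ (S : DecSetoid 0ℓ 0ℓ) where
  open DecSetoid S using (Carrier; _≈_; _≟_; setoid) renaming (sym to ≈-sym; trans to ≈-trans)

  HasSize-∃ : ∀ {P : Pred Carrier 0ℓ} → Decidable P → (U : List Carrier) →
    (∀ {p} → P p → ∃ λ u → u ∈ U × P u × p ≈ u) → ∃ (HasSize _≈_ P)
  HasSize-∃ {P} P? U covered =
    length L , L , refl , All.deduplicate⁺ _≟_ (All.all-filter P? U) , DecSetoidUnique.deduplicate-! S _ , L-covers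
    where
    L = deduplicate _≟_ (filter P? U)
    L-covers : ∀ p → P p → Any (p ≈_) L
    L-covers p Pp with u , u∈U , Pu , p≈u ← covered Pp =
      SetoidMembershipₚ.∈-deduplicate⁺ setoid _≟_ (λ z≈y x≈y → ≈-trans x≈y (≈-sym z≈y))
        (Any.map (λ { refl → p≈u }) (∈-filter⁺ P? u∈U Pu))

sublists : ∀ {A : Set} → List A → List (List A)
sublists []       = [ [] ]
sublists (x ∷ xs) = map (x ∷_) (sublists xs) ++ sublists xs

filter∈sublists : ∀ {A : Set} {P : Pred A 0ℓ} (P? : Decidable P) xs → filter P? xs ∈ sublists xs
filter∈sublists P? []       = here refl
filter∈sublists P? (x ∷ xs) with does (P? x)
... | true  = ∈-++⁺ˡ (∈-map⁺ (x ∷_) (filter∈sublists P? xs))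
... | false = ∈-++⁺ʳ (map (x ∷_) (sublists xs)) (filter∈sublists P? xs)

nonempty : ∀ {A : Set} {xs : List A} {α} → 1 ≤ α → length xs ≡ α → ∃ (_∈ xs)
nonempty {xs = []}    () refl
nonempty {xs = x ∷ _} _  _    = x , here refl

Unique-map-∈ : ∀ {X Y : Set} {f : X → Y} {xs} → (∀ {u v} → u ∈ xs → v ∈ xs → f u ≡ f v → u ≡ v) →
  Unique xs → Unique (map f xs)
Unique-map-∈ f-inj = Unique-map⁺ (≡.setoid _) (≡.setoid _) f-inj (All.tabulate (λ u∈xs → u∈xs))

map-⊆⁻ : ∀ {X Y : Set} {f : X → Y} {xs ys} → (∀ {u v} → u ∈ xs → v ∈ ys → f u ≡ f v → u ≡ v) →
  (∀ {w} → w ∈ map f xs → w ∈ map f ys) → ∀ {u} → u ∈ xs → u ∈ ys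
map-⊆⁻ {f = f} {ys = ys} f-inj fxs⊆fys u∈xs
  with v , v∈ys , fu≡fv ← ∈-map⁻ f (fxs⊆fys (∈-map⁺ f u∈xs)) =
  ≡.subst (_∈ ys) (≡.sym (f-inj u∈xs v∈ys fu≡fv)) v∈ys

-- Finite sets of points

_≟ₚ_ : ∀ {d} → DecidableEquality (Point d)
_≟ₚ_ = Vec.≡-dec ℤ._≟_

⊕-identityʳ : ∀ {d} (a : Point d) → a ⊕ origin ≡ a
⊕-identityʳ = Vec.zipWith-identityʳ ℤ.+-identityʳ

⊕-cancelˡ : ∀ {d} (a : Point d) {b b′} → a ⊕ b ≡ a ⊕ b′ → b ≡ b′
⊕-cancelˡ []       {[]}    {[]}     _  = refl
⊕-cancelˡ (a ∷ as) {b ∷ _} {b′ ∷ _} eq =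
  ≡.cong₂ _∷_ (∙-cancelˡ a b b′ (Vec.∷-injectiveˡ eq)) (⊕-cancelˡ as (Vec.∷-injectiveʳ eq))

NonNeg⇒map+ : ∀ {d} {b : Point d} → NonNeg b → ∃ λ r → b ≡ Vec.map +_ r
NonNeg⇒map+ {b = []}     _   = [] , refl
NonNeg⇒map+ {b = _ ∷ bs} b≥0 with rs , refl ← NonNeg⇒map+ {b = bs} (b≥0 ∘ suc) with b≥0 zero
... | +≤+ {n = r} _ = r ∷ rs , refl

InSum? : ∀ {d} (A B : FinSet d) c → Dec (InSum A B c)
InSum? A B c = map′ witness search (Any.any? (λ a → Any.any? (λ b → c ≟ₚ (a ⊕ b)) B) A)
  where
  witness : Any (λ a → Any (λ b → c ≡ a ⊕ b) B) A → InSum A B c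
  witness found with a , a∈A , found′ ← find found with b , b∈B , c≡a+b ← find found′ =
    a , b , a∈A , b∈B , c≡a+b
  search : InSum A B c → Any (λ a → Any (λ b → c ≡ a ⊕ b) B) A
  search (a , b , a∈A , b∈B , c≡a+b) = lose a∈A (lose b∈B c≡a+b)

module _ {d : ℕ} where
  open DecMembership (_≟ₚ_ {d}) using (_∈?_)

  SameSet? : B.Decidable (SameSet {d})
  SameSet? A A′ = map′ (λ (A⊆A′ , A′⊆A) v → mk⇔ (All.lookup A⊆A′) (All.lookup A′⊆A))
                       (λ A≈A′ → All.tabulate (Equivalence.to (A≈A′ _))
                               , All.tabulate (Equivalence.from (A≈A′ _)))
                       (All.all? (_∈? A′) A ×-dec All.all? (_∈? A) A′)

  samePairs : DecSetoid 0ℓ 0ℓ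
  samePairs = record
    { Carrier = FinSet d × FinSet d
    ; _≈_ = SamePair
    ; isDecEquivalence = record
      { isEquivalence = record
        { refl  = (λ _ → ⇔.refl) , (λ _ → ⇔.refl)
        ; sym   = λ (A≈ , B≈) → (λ v → ⇔.sym (A≈ v)) , (λ v → ⇔.sym (B≈ v))
        ; trans = λ (A≈ , B≈) (A≈′ , B≈′) → (λ v → ⇔.trans (A≈ v) (A≈′ v))
                                          , (λ v → ⇔.trans (B≈ v) (B≈′ v))
        }
      ; _≟_ = λ (A , B) (A′ , B′) → SameSet? A A′ ×-dec SameSet? B B′
      }
    }

  SameSet⇒length≡ : ∀ {A A′ : FinSet d} → Unique A → Unique A′ → SameSet A A′ → length A ≡ length A′
  SameSet⇒length≡ A! A′! A≈A′ = ℕ.≤-antisym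
    (Unique-⊆⇒length≤ (≡.setoid _) A!  (Equivalence.to   (A≈A′ _)))
    (Unique-⊆⇒length≤ (≡.setoid _) A′! (Equivalence.from (A≈A′ _)))

  SameSet-map⁻ : ∀ {e} {f : Point d → Point e} {A A′ : FinSet d} →
    (∀ {u v} → u ∈ A → v ∈ A′ → f u ≡ f v → u ≡ v) → SameSet (map f A) (map f A′) → SameSet A A′
  SameSet-map⁻ f-inj fA≈fA′ _ = mk⇔
    (map-⊆⁻ f-inj (Equivalence.to (fA≈fA′ _)))
    (map-⊆⁻ (λ v∈A′ u∈A fv≡fu → ≡.sym (f-inj u∈A v∈A′ (≡.sym fv≡fu))) (Equivalence.from (fA≈fA′ _)))

  InSum-mono : ∀ {A B A′ B′ : FinSet d} {c} → (∀ {a} → a ∈ A → a ∈ A′) → (∀ {b} → b ∈ B → b ∈ B′) →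
    InSum A B c → InSum A′ B′ c
  InSum-mono A⊆A′ B⊆B′ (a , b , a∈A , b∈B , c≡a+b) = a , b , A⊆A′ a∈A , B⊆B′ b∈B , c≡a+b

  InT-resp : ∀ {α x A B A′ B′} → Unique A′ → Unique B′ → SamePair (A , B) (A′ , B′) →
    InT α x (A , B) → InT α x (A′ , B′)
  InT-resp A′! B′! (A≈A′ , B≈B′) (A! , B! , A+B=C , |C|≡ , |A|≡α , 0∈B , B≥0) =
    A′! , B′! ,
    (λ c → ⇔.trans (A+B=C c)
                   (mk⇔ (InSum-mono (to A≈A′) (to B≈B′)) (InSum-mono (from A≈A′) (from B≈B′)))) ,
    ≡.trans |C|≡ (≡.cong₂ ℕ._*_ |A|≡|A′| (SameSet⇒length≡ B! B′! B≈B′)) ,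
    ≡.trans (≡.sym |A|≡|A′|) |A|≡α ,
    to B≈B′ 0∈B ,
    All.tabulate (All.lookup B≥0 ∘ from B≈B′)
    where
    |A|≡|A′| = SameSet⇒length≡ A! A′! A≈A′
    to : ∀ {X Y : FinSet d} → SameSet X Y → ∀ {v} → v ∈ X → v ∈ Y
    to X≈Y = Equivalence.to (X≈Y _)
    from : ∀ {X Y : FinSet d} → SameSet X Y → ∀ {v} → v ∈ Y → v ∈ X
    from X≈Y = Equivalence.from (X≈Y _)

-- Mixed-radix digits

Digits : ∀ {d} → Vec ℕ d → Vec ℕ d → Set
Digits x r = Pointwise _<_ r x

horner : ∀ {d} → Vec ℕ d → Vec ℕ d → ℕ
horner []       []       = 0
horner (x ∷ xs) (r ∷ rs) = r ℕ.+ x ℕ.* horner xs rs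

place-value-< : ∀ {x r r′ m m′} → r < x → m < m′ → r ℕ.+ x ℕ.* m < r′ ℕ.+ x ℕ.* m′
place-value-< {x} {r} {r′} {m} {m′} r<x m<m′ = begin-strict
  r ℕ.+ x ℕ.* m    <⟨ ℕ.+-monoˡ-< (x ℕ.* m) r<x ⟩
  x ℕ.+ x ℕ.* m    ≡⟨ ℕ.*-suc x m ⟨
  x ℕ.* suc m      ≤⟨ ℕ.*-monoʳ-≤ x m<m′ ⟩
  x ℕ.* m′         ≤⟨ ℕ.m≤n+m (x ℕ.* m′) r′ ⟩
  r′ ℕ.+ x ℕ.* m′  ∎
  where open ℕ.≤-Reasoning

horner<vprod : ∀ {d} {x r : Vec ℕ d} → Digits x r → horner x r < vprod x
horner<vprod []            = s≤s z≤n
horner<vprod (r<x ∷ rs<xs) = place-value-< {r′ = 0} r<x (horner<vprod rs<xs)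

horner-injective : ∀ {d} {x r r′ : Vec ℕ d} → Digits x r → Digits x r′ → horner x r ≡ horner x r′ → r ≡ r′
horner-injective [] [] _ = refl
horner-injective {x = x ∷ xs} {r ∷ rs} {r′ ∷ rs′} (r<x ∷ rs<xs) (r′<x ∷ rs′<xs) eq
  with ℕ.<-cmp (horner xs rs) (horner xs rs′)
... | tri< h<h′ _ _ = contradiction eq (ℕ.<⇒≢ (place-value-< r<x h<h′))
... | tri> _ _ h>h′ = contradiction (≡.sym eq) (ℕ.<⇒≢ (place-value-< r′<x h>h′))
... | tri≈ _ h≡h′ _ =
  ≡.cong₂ _∷_ (ℕ.+-cancelʳ-≡ _ r r′ (≡.trans eq (≡.cong (λ h → r′ ℕ.+ x ℕ.* h) (≡.sym h≡h′))))
              (horner-injective rs<xs rs′<xs h≡h′)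

horner-surjective : ∀ {d} {x : Vec ℕ d} → VecAll.All (1 ≤_) x →
  ∀ {t} → t < vprod x → ∃ λ r → Digits x r × horner x r ≡ t
horner-surjective {x = []} VecAll.[] (s≤s z≤n) = [] , [] , refl
horner-surjective {x = suc x ∷ xs} (_ VecAll.∷ 1≤xs) {t} t<P
  with rs , rs<xs , h≡t/x ← horner-surjective 1≤xs
                              (m<n*o⇒m/o<n (ℕ.<-≤-trans t<P (ℕ.≤-reflexive (ℕ.*-comm (suc x) _)))) =
  t % suc x ∷ rs , m%n<n t (suc x) ∷ rs<xs , (begin
    t % suc x ℕ.+ suc x ℕ.* horner xs rs  ≡⟨ ≡.cong (λ h → t % suc x ℕ.+ suc x ℕ.* h) h≡t/x ⟩
    t % suc x ℕ.+ suc x ℕ.* (t / suc x)   ≡⟨ ≡.cong (t % suc x ℕ.+_) (ℕ.*-comm (suc x) (t / suc x)) ⟩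
    t % suc x ℕ.+ t / suc x ℕ.* suc x     ≡⟨ m≡m%n+[m/n]*n t (suc x) ⟨
    t                                     ∎)
  where open ≡.≡-Reasoning

digitVectors : ∀ {d} → Vec ℕ d → List (Vec ℕ d)
digitVectors []       = [ [] ]
digitVectors (x ∷ xs) = cartesianProductWith _∷_ (upTo x) (digitVectors xs)

Digits⇒∈digitVectors : ∀ {d} {x r : Vec ℕ d} → Digits x r → r ∈ digitVectors x
Digits⇒∈digitVectors []            = here refl
Digits⇒∈digitVectors (r<x ∷ rs<xs) = ∈-cartesianProductWith⁺ _∷_ (∈-upTo⁺ r<x) (Digits⇒∈digitVectors rs<xs)

-- Boxes

boxPoint : ∀ {d} → Vec ℕ d → Point d
boxPoint = Vec.map (λ r → + suc r)

InBox-boxPoint : ∀ {d} {x r : Vec ℕ d} → Digits x r → InBox x (boxPoint r)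
InBox-boxPoint (r<x ∷ _)   zero    = +≤+ (s≤s z≤n) , +≤+ r<x
InBox-boxPoint (_ ∷ rs<xs) (suc i) = InBox-boxPoint rs<xs i

InBox⇒boxPoint : ∀ {d} {x : Vec ℕ d} {c} → InBox x c → ∃ λ r → Digits x r × c ≡ boxPoint r
InBox⇒boxPoint {x = []}     {[]}     _   = [] , [] , refl
InBox⇒boxPoint {x = _ ∷ xs} {_ ∷ cs} c∈x
  with rs , rs<xs , refl ← InBox⇒boxPoint {x = xs} {cs} (c∈x ∘ suc)
  with c∈x zero
... | +≤+ {n = suc r} (s≤s z≤n) , +≤+ r<x = r ∷ rs , r<x ∷ rs<xs , refl

offset-Digits : ∀ {d} {x r : Vec ℕ d} {a} → InBox x a → InBox x (a ⊕ Vec.map +_ r) → Digits x r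
offset-Digits {x = []}     {[]}    {[]}     _   _     = []
offset-Digits {x = _ ∷ xs} {_ ∷ _} {_ ∷ as} a∈x a+r∈x =
  ℤ.drop‿+≤+ (ℤ.≤-trans (ℤ.+-monoˡ-≤ _ (proj₁ (a∈x zero))) (proj₂ (a+r∈x zero)))
  ∷ offset-Digits {x = xs} {a = as} (a∈x ∘ suc) (a+r∈x ∘ suc)

SumIsBox : ∀ {d} → Vec ℕ d → FinSet d → FinSet d → Set
SumIsBox x A B = ∀ c → InBox x c ⇔ InSum A B c

module _ {d} (x : Vec ℕ d) {A B : FinSet d} (A+B=C : SumIsBox x A B) where

  ⊕-InBox : ∀ {a b} → a ∈ A → b ∈ B → InBox x (a ⊕ b)
  ⊕-InBox a∈A b∈B = Equivalence.from (A+B=C _) (_ , _ , a∈A , b∈B , refl)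

  A⊆box : origin ∈ B → ∀ {a} → a ∈ A → InBox x a
  A⊆box 0∈B {a} a∈A = ≡.subst (InBox x) (⊕-identityʳ a) (⊕-InBox a∈A 0∈B)

-- Flattening a box onto an interval

ones : ∀ {d} → Point d
ones = Vec.replicate _ (+ 1)

hornerℤ : ∀ {d} → Vec ℕ d → Point d → ℤ
hornerℤ []       []       = + 0
hornerℤ (x ∷ xs) (c ∷ cs) = c ℤ.+ + x ℤ.* hornerℤ xs cs

hornerℤ-⊕ : ∀ {d} (x : Vec ℕ d) u v → hornerℤ x (u ⊕ v) ≡ hornerℤ x u ℤ.+ hornerℤ x v
hornerℤ-⊕ []       []       []       = refl
hornerℤ-⊕ (x ∷ xs) (u ∷ us) (v ∷ vs) rewrite hornerℤ-⊕ xs us vs =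
  distrib u v (+ x) (hornerℤ xs us) (hornerℤ xs vs)
  where
  distrib : ∀ u v x h k → u ℤ.+ v ℤ.+ x ℤ.* (h ℤ.+ k) ≡ u ℤ.+ x ℤ.* h ℤ.+ (v ℤ.+ x ℤ.* k)
  distrib = solve-∀

hornerℤ-origin : ∀ {d} (x : Vec ℕ d) → hornerℤ x origin ≡ + 0
hornerℤ-origin []       = refl
hornerℤ-origin (x ∷ xs) rewrite hornerℤ-origin xs | ℤ.*-zeroʳ (+ x) = refl

hornerℤ-+ : ∀ {d} (x r : Vec ℕ d) → hornerℤ x (Vec.map +_ r) ≡ + horner x r
hornerℤ-+ []       []       = refl
hornerℤ-+ (x ∷ xs) (r ∷ rs) = begin
  + r ℤ.+ + x ℤ.* hornerℤ xs (Vec.map +_ rs)  ≡⟨ ≡.cong (λ h → + r ℤ.+ + x ℤ.* h) (hornerℤ-+ xs rs) ⟩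
  + r ℤ.+ + x ℤ.* + horner xs rs              ≡⟨ ≡.cong (λ h → + r ℤ.+ h) (ℤ.pos-* x (horner xs rs)) ⟨
  + r ℤ.+ + (x ℕ.* horner xs rs)              ≡⟨ ℤ.pos-+ r _ ⟨
  + (r ℕ.+ x ℕ.* horner xs rs)                ∎
  where open ≡.≡-Reasoning

hornerℤ-nonneg : ∀ {d} (x : Vec ℕ d) {b} → NonNeg b → + 0 ℤ.≤ hornerℤ x b
hornerℤ-nonneg x {b} b≥0 with r , refl ← NonNeg⇒map+ {b = b} b≥0 =
  ≡.subst (+ 0 ℤ.≤_) (≡.sym (hornerℤ-+ x r)) (+≤+ z≤n)

boxPoint≡ones⊕ : ∀ {d} (r : Vec ℕ d) → boxPoint r ≡ ones ⊕ Vec.map +_ r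
boxPoint≡ones⊕ []       = refl
boxPoint≡ones⊕ (r ∷ rs) = ≡.cong (+ suc r ∷_) (boxPoint≡ones⊕ rs)

hornerℤ-boxPoint : ∀ {d} (x r : Vec ℕ d) → hornerℤ x (boxPoint r) ≡ hornerℤ x ones ℤ.+ + horner x r
hornerℤ-boxPoint x r = begin
  hornerℤ x (boxPoint r)                       ≡⟨ ≡.cong (hornerℤ x) (boxPoint≡ones⊕ r) ⟩
  hornerℤ x (ones ⊕ Vec.map +_ r)              ≡⟨ hornerℤ-⊕ x ones (Vec.map +_ r) ⟩
  hornerℤ x ones ℤ.+ hornerℤ x (Vec.map +_ r)  ≡⟨ ≡.cong (λ h → hornerℤ x ones ℤ.+ h) (hornerℤ-+ x r) ⟩
  hornerℤ x ones ℤ.+ + horner x r              ∎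
  where open ≡.≡-Reasoning

toInterval flatten : ∀ {d} → Vec ℕ d → Point d → Point 1
toInterval x c = hornerℤ x c ℤ.- hornerℤ x ones ℤ.+ + 1 ∷ []
flatten    x b = hornerℤ x b ∷ []

toInterval-⊕ : ∀ {d} (x : Vec ℕ d) a b → toInterval x (a ⊕ b) ≡ toInterval x a ⊕ flatten x b
toInterval-⊕ x a b = ≡.cong (_∷ []) (begin
  hornerℤ x (a ⊕ b) ℤ.- e ℤ.+ + 1            ≡⟨ ≡.cong (λ h → h ℤ.- e ℤ.+ + 1) (hornerℤ-⊕ x a b) ⟩
  hornerℤ x a ℤ.+ hornerℤ x b ℤ.- e ℤ.+ + 1  ≡⟨ shift (hornerℤ x a) (hornerℤ x b) e ⟩
  hornerℤ x a ℤ.- e ℤ.+ + 1 ℤ.+ hornerℤ x b  ∎)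
  where
  open ≡.≡-Reasoning
  e = hornerℤ x ones
  shift : ∀ h k e → h ℤ.+ k ℤ.- e ℤ.+ + 1 ≡ h ℤ.- e ℤ.+ + 1 ℤ.+ k
  shift = solve-∀

toInterval-boxPoint : ∀ {d} (x r : Vec ℕ d) → toInterval x (boxPoint r) ≡ boxPoint (horner x r ∷ [])
toInterval-boxPoint x r = ≡.cong (_∷ []) (begin
  hornerℤ x (boxPoint r) ℤ.- e ℤ.+ + 1  ≡⟨ ≡.cong (λ h → h ℤ.- e ℤ.+ + 1) (hornerℤ-boxPoint x r) ⟩
  e ℤ.+ + horner x r ℤ.- e ℤ.+ + 1      ≡⟨ cancel e (+ horner x r) ⟩
  + 1 ℤ.+ + horner x r                  ∎)
  where
  open ≡.≡-Reasoning
  e = hornerℤ x ones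
  cancel : ∀ e h → e ℤ.+ h ℤ.- e ℤ.+ + 1 ≡ + 1 ℤ.+ h
  cancel = solve-∀

transport : ∀ {d} → Vec ℕ d → FinSet d × FinSet d → FinSet 1 × FinSet 1
transport x (A , B) = map (toInterval x) A , map (flatten x) B

module _ {d} (x : Vec ℕ d) where

  toInterval-InBox : ∀ {c} → InBox x c → InBox (interval (vprod x)) (toInterval x c)
  toInterval-InBox {c} c∈x with r , r<x , refl ← InBox⇒boxPoint {x = x} {c} c∈x =
    ≡.subst (InBox (interval (vprod x))) (≡.sym (toInterval-boxPoint x r)) (InBox-boxPoint (horner<vprod r<x ∷ []))

  toInterval-injective : ∀ {c c′} → InBox x c → InBox x c′ → toInterval x c ≡ toInterval x c′ → c ≡ c′
  toInterval-injective {c} {c′} c∈x c′∈x eq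
    with r  , r<x  , refl ← InBox⇒boxPoint {x = x} {c} c∈x
       | r′ , r′<x , refl ← InBox⇒boxPoint {x = x} {c′} c′∈x =
    ≡.cong boxPoint (horner-injective r<x r′<x (ℕ.suc-injective (ℤ.+-injective (Vec.∷-injectiveˡ (begin
      boxPoint (horner x r ∷ [])   ≡⟨ toInterval-boxPoint x r ⟨
      toInterval x (boxPoint r)    ≡⟨ eq ⟩
      toInterval x (boxPoint r′)   ≡⟨ toInterval-boxPoint x r′ ⟩
      boxPoint (horner x r′ ∷ [])  ∎)))))
    where open ≡.≡-Reasoning

  toInterval-surjective : VecAll.All (1 ≤_) x → ∀ {v} → InBox (interval (vprod x)) v →
    ∃ λ c → InBox x c × toInterval x c ≡ v
  toInterval-surjective 1≤x {v} v∈n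
    with t ∷ [] , t<n ∷ [] , refl ← InBox⇒boxPoint {x = interval (vprod x)} {v} v∈n
    with r , r<x , refl ← horner-surjective 1≤x t<n =
    boxPoint r , InBox-boxPoint r<x , toInterval-boxPoint x r

  flatten-injective : ∀ a {b b′} → InBox x (a ⊕ b) → InBox x (a ⊕ b′) → flatten x b ≡ flatten x b′ → b ≡ b′
  flatten-injective a {b} {b′} a+b∈x a+b′∈x eq = ⊕-cancelˡ a (toInterval-injective a+b∈x a+b′∈x (begin
    toInterval x (a ⊕ b)           ≡⟨ toInterval-⊕ x a b ⟩
    toInterval x a ⊕ flatten x b   ≡⟨ ≡.cong (toInterval x a ⊕_) eq ⟩
    toInterval x a ⊕ flatten x b′  ≡⟨ toInterval-⊕ x a b′ ⟨
    toInterval x (a ⊕ b′)          ∎))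
    where open ≡.≡-Reasoning

  transport-InT : VecAll.All (1 ≤_) x → ∀ {α} → 1 ≤ α → ∀ {A B} →
    InT α x (A , B) → InT α (interval (vprod x)) (transport x (A , B))
  transport-InT 1≤x 1≤α {A} {B} (A! , B! , A+B=C , |C|≡ , |A|≡α , 0∈B , B≥0)
    with a₀ , a₀∈A ← nonempty 1≤α |A|≡α =
    Unique-map-∈ (λ u∈A v∈A → toInterval-injective (A⊆C u∈A) (A⊆C v∈A)) A! ,
    Unique-map-∈ (λ u∈B v∈B → flatten-injective a₀ (a₀+B⊆C u∈B) (a₀+B⊆C v∈B)) B! ,
    (λ v → mk⇔ (into v) (onto v)) ,
    (begin
      vprod x ℕ.* 1                                                 ≡⟨ ℕ.*-identityʳ (vprod x) ⟩
      vprod x                                                       ≡⟨ |C|≡ ⟩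
      length A ℕ.* length B
        ≡⟨ ≡.cong₂ ℕ._*_ (List.length-map _ A) (List.length-map _ B) ⟨
      length (map (toInterval x) A) ℕ.* length (map (flatten x) B)  ∎) ,
    ≡.trans (List.length-map _ A) |A|≡α ,
    ≡.subst (_∈ map (flatten x) B) (≡.cong (_∷ []) (hornerℤ-origin x)) (∈-map⁺ (flatten x) 0∈B) ,
    All.map⁺ (All.map (λ b≥0 → λ { zero → hornerℤ-nonneg x b≥0 }) B≥0)
    where
    open ≡.≡-Reasoning
    A⊆C = A⊆box x A+B=C 0∈B
    a₀+B⊆C : ∀ {b} → b ∈ B → InBox x (a₀ ⊕ b)
    a₀+B⊆C = ⊕-InBox x A+B=C a₀∈A
    into : ∀ v → InBox (interval (vprod x)) v → InSum (map (toInterval x) A) (map (flatten x) B) v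
    into v v∈n with c , c∈x , refl ← toInterval-surjective 1≤x {v} v∈n
               with a , b , a∈A , b∈B , refl ← Equivalence.to (A+B=C c) c∈x =
      toInterval x a , flatten x b , ∈-map⁺ _ a∈A , ∈-map⁺ _ b∈B , toInterval-⊕ x a b
    onto : ∀ v → InSum (map (toInterval x) A) (map (flatten x) B) v → InBox (interval (vprod x)) v
    onto _ (_ , _ , a′∈ , b′∈ , refl)
      with a , a∈A , refl ← ∈-map⁻ _ a′∈ | b , b∈B , refl ← ∈-map⁻ _ b′∈ =
      ≡.subst (InBox (interval (vprod x))) (toInterval-⊕ x a b) (toInterval-InBox (⊕-InBox x A+B=C a∈A b∈B))

  transport-reflects : ∀ {α} → 1 ≤ α → ∀ {p q} → InT α x p → InT α x q →
    SamePair (transport x p) (transport x q) → SamePair p q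
  transport-reflects 1≤α {A , B} {A′ , B′}
    (_ , _ , A+B=C , _ , |A|≡α , 0∈B , _) (_ , _ , A′+B′=C′ , _ , _ , 0∈B′ , _) (fA≈fA′ , fB≈fB′)
    with a₀ , a₀∈A ← nonempty 1≤α |A|≡α =
    A≈A′ ,
    SameSet-map⁻ (λ u∈B v∈B′ → flatten-injective a₀ (⊕-InBox x A+B=C a₀∈A u∈B) (⊕-InBox x A′+B′=C′ a₀∈A′ v∈B′))
                 fB≈fB′
    where
    A≈A′ = SameSet-map⁻
      (λ u∈A v∈A′ → toInterval-injective (A⊆box x A+B=C 0∈B u∈A) (A⊆box x A′+B′=C′ 0∈B′ v∈A′)) fA≈fA′
    a₀∈A′ = Equivalence.to (A≈A′ a₀) a₀∈A

-- Finiteness of 𝒯(α, C)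

module _ {d} (x : Vec ℕ d) where
  open DecMembership (_≟ₚ_ {d}) using (_∈?_)

  boxPoints natPoints : FinSet d
  boxPoints = deduplicate _≟ₚ_ (map boxPoint (digitVectors x))
  natPoints = deduplicate _≟ₚ_ (map (Vec.map +_) (digitVectors x))

  boxPoints! : Unique boxPoints
  boxPoints! = DecUnique.deduplicate-! _≟ₚ_ (map boxPoint (digitVectors x))

  natPoints! : Unique natPoints
  natPoints! = DecUnique.deduplicate-! _≟ₚ_ (map (Vec.map +_) (digitVectors x))

  InBox⇒∈boxPoints : ∀ {c} → InBox x c → c ∈ boxPoints
  InBox⇒∈boxPoints {c} c∈x with r , r<x , refl ← InBox⇒boxPoint {x = x} {c} c∈x =
    ∈-deduplicate⁺ _≟ₚ_ (∈-map⁺ boxPoint (Digits⇒∈digitVectors r<x))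

  offset∈natPoints : ∀ a {b} → InBox x a → InBox x (a ⊕ b) → NonNeg b → b ∈ natPoints
  offset∈natPoints a {b} a∈x a+b∈x b≥0 with r , refl ← NonNeg⇒map+ {b = b} b≥0 =
    ∈-deduplicate⁺ _≟ₚ_ (∈-map⁺ (Vec.map +_)
      (Digits⇒∈digitVectors (offset-Digits {x = x} {a = a} a∈x a+b∈x)))

  InBox? : ∀ c → Dec (InBox x c)
  InBox? c = Fin.all? (λ i → (+ 1 ℤ.≤? Vec.lookup c i) ×-dec (Vec.lookup c i ℤ.≤? + Vec.lookup x i))

  SumIsBox? : ∀ A B → Dec (SumIsBox x A B)
  SumIsBox? A B = map′
    (λ (sums∈C , C⊆sums) c → mk⇔ (λ c∈x → All.lookup C⊆sums (InBox⇒∈boxPoints c∈x) c∈x)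
                                  (λ { (a , b , a∈A , b∈B , refl) → All.lookup (All.lookup sums∈C a∈A) b∈B }))
    (λ A+B=C → All.tabulate (λ a∈A → All.tabulate (⊕-InBox x A+B=C a∈A))
             , All.tabulate (λ _ → Equivalence.to (A+B=C _)))
    (All.all? (λ a → All.all? (λ b → InBox? (a ⊕ b)) B) A
     ×-dec All.all? (λ c → InBox? c →-dec InSum? A B c) boxPoints)

  InT? : ∀ α p → Dec (InT α x p)
  InT? α (A , B) =
    Unique? A ×-dec Unique? B ×-dec SumIsBox? A B ×-dec vprod x ℕ.≟ length A ℕ.* length B ×-dec length A ℕ.≟ α
    ×-dec origin ∈? B ×-dec All.all? NonNeg? B
    where
    Unique? : ∀ A → Dec (Unique A)
    Unique? = allPairs? (λ u v → ¬? (u ≟ₚ v))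
    NonNeg? : ∀ b → Dec (NonNeg b)
    NonNeg? b = Fin.all? (λ i → + 0 ℤ.≤? Vec.lookup b i)

  candidates : List (FinSet d × FinSet d)
  candidates = cartesianProduct (sublists boxPoints) (sublists natPoints)

  canonical : ∀ {α} → 1 ≤ α → ∀ {p} → InT α x p → ∃ λ q → q ∈ candidates × InT α x q × SamePair p q
  canonical 1≤α {A , B} T@(_ , _ , A+B=C , _ , |A|≡α , 0∈B , B≥0) with a₀ , a₀∈A ← nonempty 1≤α |A|≡α =
    (A′ , B′) ,
    ∈-cartesianProduct⁺ (filter∈sublists (_∈? A) boxPoints) (filter∈sublists (_∈? B) natPoints) ,
    InT-resp {x = x} {A′ = A′} {B′ = B′}
      (Unique.filter⁺ (_∈? A) boxPoints!) (Unique.filter⁺ (_∈? B) natPoints!) A,B≈A′,B′ T ,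
    A,B≈A′,B′
    where
    A′ = filter (_∈? A) boxPoints
    B′ = filter (_∈? B) natPoints
    A⊆C = A⊆box x A+B=C 0∈B
    A,B≈A′,B′ : SamePair (A , B) (A′ , B′)
    A,B≈A′,B′ =
      (λ _ → mk⇔ (λ a∈A → ∈-filter⁺ (_∈? A) (InBox⇒∈boxPoints (A⊆C a∈A)) a∈A)
                 (proj₂ ∘ ∈-filter⁻ (_∈? A) {xs = boxPoints})) ,
      (λ _ → mk⇔ (λ b∈B → ∈-filter⁺ (_∈? B)
                            (offset∈natPoints a₀ (A⊆C a₀∈A) (⊕-InBox x A+B=C a₀∈A b∈B) (All.lookup B≥0 b∈B)) b∈B)
                 (proj₂ ∘ ∈-filter⁻ (_∈? B) {xs = natPoints}))

  CardT-∃ : ∀ {α} → 1 ≤ α → ∃ (CardT α x)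
  CardT-∃ {α} 1≤α = HasSize-∃ samePairs (InT? α) candidates (canonical 1≤α)

lemma16 : (n : ℕ) → 1 ≤ n
    → (d : ℕ) → 1 ≤ d → (x : Vec ℕ d) → VecAll.All (1 ≤_) x → vprod x ≡ n
    → (α : ℕ) → 1 ≤ α → (k : ℕ) → CardT α x k
    → Σ ℕ (λ α′ → 1 ≤ α′ × Σ ℕ (λ k′ → CardT α′ (interval n) k′ × k ≤ k′))
lemma16 _ _ d _ x 1≤x refl α 1≤α k 𝒯[α,C] with k′ , 𝒯[α,n] ← CardT-∃ (interval (vprod x)) 1≤α =
  α , 1≤α , k′ , 𝒯[α,n] ,
  HasSize-≤ (pairs d) (pairs 1) (transport x) (transport-InT x 1≤x 1≤α) (transport-reflects x 1≤α)
    𝒯[α,C] 𝒯[α,n]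
  where pairs = λ e → DecSetoid.setoid (samePairs {e})
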